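{- Consider the fragment of $\mathbf{ACT}^+_\omega$ in the language of $\backslash$, $/$, $\wedge$, $\top$ and $^+$, where $^+$ may occur only in subformulae of the form $A^+\backslash B$ and $B/A^+$. This fragment is strongly complete with respect to L-models without the empty word: for every set $\mathcal H$ of sequents and sequent $\Pi\to C$ in this language, if $\Pi\to C$ is true in every such L-model in which all sequents of $\mathcal H$ are true, then $\mathcal H\vdash\Pi\to C$ in this fragment.
   Context: Sequents $A_1,\dots,A_n\to B$ with $n\ge1$. Rules: $A\to A$; $\Pi\to\top$; from $\Pi\to A$ and $\Gamma,B,\Delta\to C$ infer $\Gamma,\Pi,A\backslash B,\Delta\to C$ and $\Gamma,B/A,\Pi,\Delta\to C$; from $A,\Pi\to B$ infer $\Pi\to A\backslash B$ ($\Pi$ non-empty); from $\Pi,A\to B$ infer $\Pi\to B/A$ ($\Pi$ non-empty); from $\Gamma,A,\Delta\to C$ (or $\Gamma,B,\Delta\to C$) infer $\Gamma,A\wedge B,\Delta\to C$; from $\Pi\to A$, $\Pi\to B$ infer $\Pi\to A\wedge B$; Cut: from $\Pi\to A$ and $\Gamma,A,\Delta\to C$ infer $\Gamma,\Pi,\Delta\to C$; from $\Gamma,A^n,\Delta\to C$ for all $n\ge1$ infer $\Gamma,A^+,\Delta\to C$; for $n\ge1$ from $\Pi_1\to A,\dots,\Pi_n\to A$ infer $\Pi_1,\dots,\Pi_n\to A^+$. Derivations may be infinite but well-founded; hypotheses in $\mathcal H$ (non-empty antecedents) serve as extra axioms. An L-model without the empty word: an alphabet $\Sigma$ and $\alpha$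 mapping variables to subsets of $\Sigma^+$, extended by $\alpha(A\backslash B)=\{u\in\Sigma^+\mid\forall v\in\alpha(A)\;vu\in\alpha(B)\}$, $\alpha(B/A)=\{u\in\Sigma^+\mid\forall v\in\alpha(A)\;uv\in\alpha(B)\}$, $\alpha(A\wedge B)=\alpha(A)\cap\alpha(B)$, $\alpha(\top)=\Sigma^+$, $\alpha(A^+)=\bigcup_{n\ge1}\alpha(A)^n$. $A_1,\dots,A_n\to B$ is true if $\alpha(A_1)\cdots\alpha(A_n)\subseteq\alpha(B)$. -}

module Defs where

open import Data.Nat using (ℕ; zero; suc)
open import Data.List using (List; []; _∷_; _++_)
open import Data.List.NonEmpty using (List⁺; _∷_; [_]; _⁺++_; _++⁺_; _⁺++⁺_; concat; toList)
open import Data.List.NonEmpty.Relation.Unary.All using (All)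
open import Data.Product using (Σ; ∃; _×_; _,_)
open import Data.Unit using (⊤)
open import Relation.Binary.PropositionalEquality using (_≡_)

infixr 30 _╲_
infixl 30 _╱_
infixl 35 _∧_
infix 40 _⁺

data Formula : Set where
  var  : ℕ → Formula
  _╲_  : Formula → Formula → Formula
  _╱_  : Formula → Formula → Formula
  _∧_  : Formula → Formula → Formula
  ⊤f   : Formula
  _⁺   : Formula → Formula

record Sequent : Set where
  constructor _⇒_
  field
    ant : List⁺ Formula
    suc′ : Formula

infix 4 _⇒_
infix 3 _⊢_

data Frag : Formula → Set where
  var  : ∀ p → Frag (var p)
  ⊤f   : Frag ⊤f
  _╲_  : ∀ {A B} → Frag A → Frag B → Frag (A ╲ B)
  _╱_  : ∀ {A B} → Frag B → Frag A → Frag (B ╱ A)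
  _∧_  : ∀ {A B} → Frag A → Frag B → Frag (A ∧ B)
  plus╲ : ∀ {A B} → Frag A → Frag B → Frag (A ⁺ ╲ B)
  plus╱ : ∀ {A B} → Frag B → Frag A → Frag (B ╱ A ⁺)

FragSeq : Sequent → Set
FragSeq (Π ⇒ C) = All Frag Π × Frag C

-- A^n with n+1 copies (n : ℕ encodes exponent n+1 ≥ 1)
rep⁺ : ℕ → Formula → List⁺ Formula
rep⁺ zero    A = [ A ]
rep⁺ (suc n) A = A ∷ toList (rep⁺ n A)

data _⊢_ (H : Sequent → Set) : Sequent → Set where
  hyp  : ∀ {s} → H s → H ⊢ s
  ax   : ∀ {A} → H ⊢ [ A ] ⇒ A
  ⊤R   : ∀ {Π} → H ⊢ Π ⇒ ⊤f
  ╲L   : ∀ {Γ Π A B Δ C} → H ⊢ Π ⇒ A → H ⊢ Γ ++⁺ (B ∷ Δ) ⇒ C →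
         H ⊢ Γ ++⁺ (Π ⁺++ ((A ╲ B) ∷ Δ)) ⇒ C
  ╱L   : ∀ {Γ Π A B Δ C} → H ⊢ Π ⇒ A → H ⊢ Γ ++⁺ (B ∷ Δ) ⇒ C →
         H ⊢ Γ ++⁺ ((B ╱ A) ∷ (toList Π ++ Δ)) ⇒ C
  ╲R   : ∀ {Π A B} → H ⊢ (A ∷ toList Π) ⇒ B → H ⊢ Π ⇒ A ╲ B
  ╱R   : ∀ {Π A B} → H ⊢ Π ⁺++ (A ∷ []) ⇒ B → H ⊢ Π ⇒ B ╱ A
  ∧L₁  : ∀ {Γ A B Δ C} → H ⊢ Γ ++⁺ (A ∷ Δ) ⇒ C → H ⊢ Γ ++⁺ ((A ∧ B) ∷ Δ) ⇒ C
  ∧L₂  : ∀ {Γ A B Δ C} → H ⊢ Γ ++⁺ (B ∷ Δ) ⇒ C → H ⊢ Γ ++⁺ ((A ∧ B) ∷ Δ) ⇒ C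
  ∧R   : ∀ {Π A B} → H ⊢ Π ⇒ A → H ⊢ Π ⇒ B → H ⊢ Π ⇒ A ∧ B
  cut  : ∀ {Γ Π A Δ C} → H ⊢ Π ⇒ A → H ⊢ Γ ++⁺ (A ∷ Δ) ⇒ C →
         H ⊢ Γ ++⁺ (Π ⁺++ Δ) ⇒ C
  ⁺L   : ∀ {Γ A Δ C} → ((n : ℕ) → H ⊢ Γ ++⁺ (rep⁺ n A ⁺++ Δ) ⇒ C) →
         H ⊢ Γ ++⁺ ((A ⁺) ∷ Δ) ⇒ C
  ⁺R   : ∀ {A} (Πs : List⁺ (List⁺ Formula)) → All (λ Π → H ⊢ Π ⇒ A) Πs →
         H ⊢ concat Πs ⇒ A ⁺

Word : Set → Set
Word Σ′ = List⁺ Σ′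

Lang : Set → Set₁
Lang Σ′ = Word Σ′ → Set

-- Pow n L = L^(n+1)
Pow : ∀ {Σ′ : Set} → ℕ → Lang Σ′ → Lang Σ′
Pow zero    L w = L w
Pow (suc n) L w = ∃ λ u → ∃ λ v → (w ≡ u ⁺++⁺ v) × L u × Pow n L v

⟦_⟧ : ∀ {Σ′ : Set} → Formula → (ℕ → Lang Σ′) → Lang Σ′
⟦ var p ⟧ α w = α p w
⟦ A ╲ B ⟧ α u = ∀ v → ⟦ A ⟧ α v → ⟦ B ⟧ α (v ⁺++⁺ u)
⟦ B ╱ A ⟧ α u = ∀ v → ⟦ A ⟧ α v → ⟦ B ⟧ α (u ⁺++⁺ v)
⟦ A ∧ B ⟧ α w = ⟦ A ⟧ α w × ⟦ B ⟧ α w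
⟦ ⊤f ⟧ α w = ⊤
⟦ A ⁺ ⟧ α w = Σ ℕ λ n → Pow n (⟦ A ⟧ α) w

prodL : ∀ {Σ′ : Set} → Formula → List Formula → (ℕ → Lang Σ′) → Lang Σ′
prodL A []      α w = ⟦ A ⟧ α w
prodL A (B ∷ Γ) α w =
  ∃ λ u → ∃ λ v → (w ≡ u ⁺++⁺ v) × ⟦ A ⟧ α u × prodL B Γ α v

⟦_⟧* : ∀ {Σ′ : Set} → List⁺ Formula → (ℕ → Lang Σ′) → Lang Σ′
⟦ A ∷ Γ ⟧* α w = prodL A Γ α w

TrueIn : ∀ {Σ′ : Set} → (ℕ → Lang Σ′) → Sequent → Set
TrueIn α (Π ⇒ B) = ∀ w → ⟦ Π ⟧* α w → ⟦ B ⟧ α w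

{-# OPTIONS --safe #-}
-- Words are antecedents over the alphabet of formulas and a
-- variable p denotes the words w with H ⊢ w ⇒ p.  By induction on fragment
-- formulas, w belongs to ⟦ A ⟧ exactly when H ⊢ w ⇒ A.  The restriction on ⁺
-- is what makes this go through: a positive A⁺ is only ever needed as the
-- argument of \ or /, where semantic membership (a power of ⟦ A ⟧) yields a
-- derivation by ⁺R, and a negative A⁺ is decomposed by the ω-rule ⁺L into the
-- powers A^n, each of which lies in ⟦ A ⟧^n.  Consequently every hypothesis is
-- true in the canonical model, the antecedent Π lies in ⟦ Π ⟧*, and validity
-- of Π ⇒ C there yields H ⊢ Π ⇒ C.
module Submission where

open import Defs
open import Data.Nat using (ℕ; zero; suc)
open import Data.List using (List; []; _∷_; _++_)
open import Data.List.Properties using (++-identityʳ; ++-assoc)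
open import Data.List.NonEmpty using (List⁺; _∷_; [_]; _⁺++_; _++⁺_; _⁺++⁺_; concat; toList)
open import Data.List.NonEmpty.Relation.Unary.All as All⁺ using (_∷_; toList⁺)
import Data.List.Relation.Unary.All as All
open import Data.Product using (∃; _×_; _,_)
open import Data.Unit using (tt)
open import Relation.Binary.PropositionalEquality
  using (_≡_; refl; sym; trans; cong; subst)

toList-injective : ∀ {X : Set} {xs ys : List⁺ X} → toList xs ≡ toList ys → xs ≡ ys
toList-injective {xs = _ ∷ _} {_ ∷ _} refl = refl

toList-++⁺ : ∀ {X : Set} (xs : List X) ys → toList (xs ++⁺ ys) ≡ xs ++ toList ys
toList-++⁺ []       ys = refl
toList-++⁺ (x ∷ xs) ys = cong (x ∷_) (toList-++⁺ xs ys)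

Pow-concat : ∀ {X : Set} {L : Lang X} n v → Pow n L v →
             ∃ λ ws → All⁺.All L ws × toList (concat ws) ≡ toList v
Pow-concat zero    v Lv = [ v ] , Lv ∷ All.[] , ++-identityʳ (toList v)
Pow-concat (suc n) _ (u , v , refl , Lu , Lⁿv) with Pow-concat n v Lⁿv
... | ws , Lws , ws≡v = u ∷ toList ws , Lu ∷ toList⁺ Lws , cong (toList u ++_) ws≡v

Pow-rep⁺ : ∀ {L : Lang Formula} {A} n → L [ A ] → Pow n L (rep⁺ n A)
Pow-rep⁺ zero    LA = LA
Pow-rep⁺ {A = A} (suc n) LA = [ A ] , rep⁺ n A , refl , LA , Pow-rep⁺ n LA

module _ (H : Sequent → Set) where

  -- The rules build antecedents with ++⁺, ⁺++ and ⁺++⁺, which do not compute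
  -- against each other; under toList they all become ordinary list _++_.
  cast : ∀ {S T C} → toList S ≡ toList T → H ⊢ S ⇒ C → H ⊢ T ⇒ C
  cast {C = C} S≡T = subst (λ S → H ⊢ S ⇒ C) (toList-injective S≡T)

  cut-at : ∀ Γ Δ {Π A S T C} → H ⊢ Π ⇒ A → H ⊢ S ⇒ C →
           toList S ≡ Γ ++ A ∷ Δ → toList T ≡ Γ ++ toList Π ++ Δ → H ⊢ T ⇒ C
  cut-at Γ Δ {Π} {A} d e S≡ T≡ =
    cast (trans (toList-++⁺ Γ (Π ⁺++ Δ)) (sym T≡))
      (cut {Γ = Γ} {Δ = Δ} d (cast (trans S≡ (sym (toList-++⁺ Γ (A ∷ Δ)))) e))

  cut-single : ∀ {Π A C} → H ⊢ Π ⇒ A → H ⊢ [ A ] ⇒ C → H ⊢ Π ⇒ C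
  cut-single {Π} d e = cut-at [] [] d e refl (sym (++-identityʳ (toList Π)))

  ╲-apply : ∀ {u v A B} → H ⊢ v ⇒ A → H ⊢ u ⇒ A ╲ B → H ⊢ v ⁺++⁺ u ⇒ B
  ╲-apply {u} {v} dv du =
    cut-at (toList v) [] du (╲L {Γ = []} {Δ = []} dv ax) refl
      (cong (toList v ++_) (sym (++-identityʳ (toList u))))

  ╱-apply : ∀ {u v A B} → H ⊢ u ⇒ B ╱ A → H ⊢ v ⇒ A → H ⊢ u ⁺++⁺ v ⇒ B
  ╱-apply {u} {v} du dv =
    cut-at [] (toList v ++ []) du (╱L {Γ = []} {Δ = []} dv ax) refl
      (cong (toList u ++_) (sym (++-identityʳ (toList v))))

  canonical : ℕ → Lang Formula
  canonical p w = H ⊢ w ⇒ var p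

  mutual
    ⊨⇒⊢ : ∀ {A} → Frag A → ∀ w → ⟦ A ⟧ canonical w → H ⊢ w ⇒ A
    ⊨⇒⊢ (var p)  w x = x
    ⊨⇒⊢ ⊤f       w _ = ⊤R
    ⊨⇒⊢ (_╲_ {A} fA fB) _ f = ╲R (⊨⇒⊢ fB _ (f [ A ] (⊢⇒⊨ fA _ ax)))
    ⊨⇒⊢ (_╱_ {A} fB fA) _ f = ╱R (⊨⇒⊢ fB _ (f [ A ] (⊢⇒⊨ fA _ ax)))
    ⊨⇒⊢ (fA ∧ fB) w (a , b) = ∧R (⊨⇒⊢ fA w a) (⊨⇒⊢ fB w b)
    ⊨⇒⊢ (plus╲ {A} fA fB) u f =
      ╲R (⁺L {Γ = []} λ n → ⊨⇒⊢ fB _ (f (rep⁺ n A) (n , Pow-rep⁺ n (⊢⇒⊨ fA _ ax))))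
    ⊨⇒⊢ (plus╱ {A} fB fA) u f =
      ╱R (cast (toList-++⁺ (toList u) _) (⁺L {Γ = toList u} {Δ = []} λ n →
        cast (sym (trans (toList-++⁺ (toList u) _) (cong (toList u ++_) (++-identityʳ _))))
          (⊨⇒⊢ fB _ (f (rep⁺ n A) (n , Pow-rep⁺ n (⊢⇒⊨ fA _ ax))))))

    ⊢⇒⊨ : ∀ {A} → Frag A → ∀ w → H ⊢ w ⇒ A → ⟦ A ⟧ canonical w
    ⊢⇒⊨ (var p)  w d = d
    ⊢⇒⊨ ⊤f       w d = tt
    ⊢⇒⊨ (fA ╲ fB) u d v a = ⊢⇒⊨ fB _ (╲-apply (⊨⇒⊢ fA v a) d)
    ⊢⇒⊨ (fB ╱ fA) u d v a = ⊢⇒⊨ fB _ (╱-apply d (⊨⇒⊢ fA v a))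
    ⊢⇒⊨ (fA ∧ fB) w d =
      ⊢⇒⊨ fA w (cut-single d (∧L₁ {Γ = []} {Δ = []} ax)) ,
      ⊢⇒⊨ fB w (cut-single d (∧L₂ {Γ = []} {Δ = []} ax))
    ⊢⇒⊨ (plus╲ fA fB) u d v a⁺ = ⊢⇒⊨ fB _ (╲-apply (⊨⁺⇒⊢ fA v a⁺) d)
    ⊢⇒⊨ (plus╱ fB fA) u d v a⁺ = ⊢⇒⊨ fB _ (╱-apply d (⊨⁺⇒⊢ fA v a⁺))

    ⊨⁺⇒⊢ : ∀ {A} → Frag A → ∀ w → ⟦ A ⁺ ⟧ canonical w → H ⊢ w ⇒ A ⁺
    ⊨⁺⇒⊢ fA w (n , aⁿ) with Pow-concat n w aⁿ
    ... | ws , a ∷ as , ws≡w = cast ws≡w (⁺R ws (⊨⇒⊢ fA _ a ∷ All.map (⊨⇒⊢ fA _) as))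

  prodL-cut : ∀ Θ Γ {A S T C} w → Frag A → All.All Frag Γ → H ⊢ S ⇒ C →
              toList S ≡ Θ ++ A ∷ Γ → toList T ≡ Θ ++ toList w →
              prodL A Γ canonical w → H ⊢ T ⇒ C
  prodL-cut Θ [] w fA _ d S≡ T≡ a =
    cut-at Θ [] (⊨⇒⊢ fA w a) d S≡ (trans T≡ (cong (Θ ++_) (sym (++-identityʳ _))))
  prodL-cut Θ (B ∷ Γ) _ fA (fB All.∷ fΓ) d S≡ T≡ (u , v , refl , a , bΓ) =
    prodL-cut (Θ ++ toList u) Γ v fB fΓ d′ (toList-++⁺ _ _)
      (trans T≡ (sym (++-assoc Θ (toList u) (toList v)))) bΓ
    where
    d′ : H ⊢ (Θ ++ toList u) ++⁺ (B ∷ Γ) ⇒ _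
    d′ = cut-at Θ (B ∷ Γ) (⊨⇒⊢ fA u a) d S≡
           (trans (toList-++⁺ _ _) (++-assoc Θ (toList u) (B ∷ Γ)))

  antecedent∈prodL : ∀ {A} Γ → Frag A → All.All Frag Γ → prodL A Γ canonical (A ∷ Γ)
  antecedent∈prodL []      fA _ = ⊢⇒⊨ fA _ ax
  antecedent∈prodL {A} (B ∷ Γ) fA (fB All.∷ fΓ) =
    [ A ] , B ∷ Γ , refl , ⊢⇒⊨ fA _ ax , antecedent∈prodL Γ fB fΓ

  hypotheses-true : (∀ h → H h → FragSeq h) → ∀ h → H h → TrueIn canonical h
  hypotheses-true frag ((A ∷ Γ) ⇒ B) Hh w w∈ with frag _ Hh
  ... | (fA ∷ fΓ) , fB = ⊢⇒⊨ fB w (prodL-cut [] Γ w fA fΓ (hyp Hh) refl refl w∈)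

corollary3 : (H : Sequent → Set) (s : Sequent) →
    (∀ h → H h → FragSeq h) → FragSeq s →
    ((Σ′ : Set) (α : ℕ → Lang Σ′) → (∀ h → H h → TrueIn α h) → TrueIn α s) →
    H ⊢ s
corollary3 H ((A ∷ Γ) ⇒ C) frag ((fA ∷ fΓ) , fC) valid =
  ⊨⇒⊢ H fC _ (valid Formula (canonical H) (hypotheses-true H frag)
                (A ∷ Γ) (antecedent∈prodL H Γ fA fΓ))
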